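{- Let $G_1$ be a connected graph having no pair of false twins, and let $G_2$ be a graph whose false-twin equivalence classes $G^2_1,\dots,G^2_s$ all satisfy $|G^2_j|\ge 2$. Then $\mathrm{fix}(G_1*G_2)=|V(G_1)|\,\mathrm{fix}(G_2)$.
   Context: All graphs are finite and simple. For graphs $G_1,G_2$, the co-normal product $G_1*G_2$ is the graph with vertex set $V(G_1)\times V(G_2)$ in which $(a,b)$ and $(c,d)$ are adjacent if and only if $a$ is adjacent to $c$ in $G_1$ or $b$ is adjacent to $d$ in $G_2$. Two distinct vertices $u,v$ are false twins if $N(u)=N(v)$ (open neighborhoods); the false-twin equivalence classes are the classes of the relation $u\equiv v$ iff $N(u)=N(v)$. A set $F\subseteq V(G)$ is a fixing set of $G$ if the only automorphism of $G$ fixing every vertex of $F$ is the identity; $\mathrm{fix}(G)$ is the minimum cardinality of a fixing set. -}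

module Defs where

open import Data.Nat using (ℕ; _*_; _≤_)
open import Data.Bool using (Bool; true; false; _∨_)
open import Data.Fin using (Fin; combine; remQuot)
open import Data.Fin.Subset using (Subset; _∈_; ∣_∣)
open import Data.Fin.Permutation using (Permutation′; _⟨$⟩ʳ_)
open import Data.Product using (Σ; ∃; _×_; _,_; proj₁; proj₂)
open import Relation.Binary.PropositionalEquality using (_≡_; _≢_; refl; cong₂)
open import Relation.Binary.Construct.Closure.ReflexiveTransitive using (Star)

record Graph : Set where
  field
    n     : ℕ
    adj   : Fin n → Fin n → Bool
    sym   : ∀ u v → adj u v ≡ adj v u
    irr   : ∀ u → adj u u ≡ false
open Graph public

V : Graph → Set
V G = Fin (n G)

Adj : (G : Graph) → V G → V G → Set
Adj G u v = adj G u v ≡ true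

-- Co-normal product: vertex set V(G₁) × V(G₂), encoded as Fin (n₁ * n₂) via
-- the standard bijection combine / remQuot.
conormal-adj : (G₁ G₂ : Graph) → Fin (n G₁ * n G₂) → Fin (n G₁ * n G₂) → Bool
conormal-adj G₁ G₂ x y =
  let (a , b) = remQuot {n G₁} (n G₂) x
      (c , d) = remQuot {n G₁} (n G₂) y
  in adj G₁ a c ∨ adj G₂ b d


conormal-sym : (G₁ G₂ : Graph) → ∀ x y → conormal-adj G₁ G₂ x y ≡ conormal-adj G₁ G₂ y x
conormal-sym G₁ G₂ x y =
  cong₂ _∨_ (Graph.sym G₁ (proj₁ (remQuot {n G₁} (n G₂) x)) (proj₁ (remQuot {n G₁} (n G₂) y)))
            (Graph.sym G₂ (proj₂ (remQuot {n G₁} (n G₂) x)) (proj₂ (remQuot {n G₁} (n G₂) y)))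

conormal-irr : (G₁ G₂ : Graph) → ∀ x → conormal-adj G₁ G₂ x x ≡ false
conormal-irr G₁ G₂ x
  rewrite irr G₁ (proj₁ (remQuot {n G₁} (n G₂) x))
        | irr G₂ (proj₂ (remQuot {n G₁} (n G₂) x)) = refl

_⊛_ : Graph → Graph → Graph
G₁ ⊛ G₂ = record
  { n   = n G₁ * n G₂
  ; adj = conormal-adj G₁ G₂
  ; sym = conormal-sym G₁ G₂
  ; irr = conormal-irr G₁ G₂
  }

Connected : Graph → Set
Connected G = ∀ (u v : V G) → Star (Adj G) u v

SameNbhd : (G : Graph) → V G → V G → Set
SameNbhd G u v = ∀ w → adj G u w ≡ adj G v w

NoFalseTwins : Graph → Set
NoFalseTwins G = ∀ (u v : V G) → SameNbhd G u v → u ≡ v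

AllTwinClassesNontrivial : Graph → Set
AllTwinClassesNontrivial G = ∀ (u : V G) → Σ (V G) λ v → (v ≢ u) × SameNbhd G u v

IsAutomorphism : (G : Graph) → Permutation′ (n G) → Set
IsAutomorphism G σ = ∀ u v → adj G (σ ⟨$⟩ʳ u) (σ ⟨$⟩ʳ v) ≡ adj G u v

IsFixingSet : (G : Graph) → Subset (n G) → Set
IsFixingSet G F = ∀ (σ : Permutation′ (n G)) → IsAutomorphism G σ →
                  (∀ v → v ∈ F → σ ⟨$⟩ʳ v ≡ v) → ∀ v → σ ⟨$⟩ʳ v ≡ v

FixNumber : Graph → ℕ → Set
FixNumber G k = (Σ (Subset (n G)) λ F → IsFixingSet G F × ∣ F ∣ ≡ k)
              × (∀ F → IsFixingSet G F → k ≤ ∣ F ∣)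

-- Call F a twin cover of H if of any two distinct false twins at least one
-- lies in F.  Swapping two false twins is an automorphism, so every fixing
-- set is a twin cover; conversely, when no false-twin class is a singleton,
-- every twin cover is a fixing set.  The fixing sets of such graphs are
-- therefore exactly their twin covers.
--
-- In the co-normal product P = G₁ * G₂, with G₁ free of false twins, two
-- vertices (a,b), (c,d) are false twins iff a = c and b, d are false twins
-- of G₂.  Hence F is a twin cover of P iff every slice
-- F_a = { b | (a,b) ∈ F } is a twin cover of G₂, and P inherits non-trivial
-- twin classes from G₂.  So F fixes P iff every slice fixes G₂.  As
-- |F| = Σ_a |F_a|, a minimum fixing set of P is V(G₁) × F₂ with F₂ a minimum
-- fixing set of G₂, which gives the theorem.
module Submission where

open import Defs hiding (sym)
open import Data.Nat using (ℕ; _*_; zero; suc; _+_; _≤_; z≤n)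
open import Data.Nat.Properties using (+-assoc; +-mono-≤)
open import Data.Bool using (Bool; true; false; _∨_)
open import Data.Bool.Properties using (∨-identityʳ)
open import Data.Fin using (Fin; zero; suc; combine; remQuot; _↑ˡ_; _↑ʳ_; _≟_)
open import Data.Fin.Properties using (remQuot-combine; combine-remQuot)
open import Data.Fin.Subset using (Subset; _∈_; ∣_∣)
open import Data.Fin.Subset.Properties using (_∈?_)
open import Data.Fin.Permutation using (_⟨$⟩ʳ_; _⟨$⟩ˡ_; inverseˡ; inverseʳ; transpose)
import Data.Fin.Permutation.Components as PC
open import Data.Vec using (_∷_; []; lookup; tabulate)
open import Data.Vec.Properties using (lookup∘tabulate; tabulate∘lookup; tabulate-cong; []=⇒lookup; lookup⇒[]=)
open import Data.Product using (_×_; _,_; proj₁; proj₂)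
open import Data.Sum using (_⊎_; inj₁; inj₂)
open import Data.Empty using (⊥-elim)
open import Relation.Nullary using (yes; no)
open import Relation.Binary.PropositionalEquality
  using (_≡_; _≢_; refl; sym; trans; cong; cong₂; subst; subst₂; module ≡-Reasoning)

transpose-sends : ∀ {m} (u v : Fin m) → PC.transpose u v u ≡ v
transpose-sends u v with u ≟ u
... | yes _ = refl
... | no u≢u = ⊥-elim (u≢u refl)

transpose-fixes : ∀ {m} (u v w : Fin m) → w ≢ u → w ≢ v → PC.transpose u v w ≡ w
transpose-fixes u v w w≢u w≢v with w ≟ u
... | yes w≡u = ⊥-elim (w≢u w≡u)
... | no _ with w ≟ v
...   | yes w≡v = ⊥-elim (w≢v w≡v)
...   | no _ = refl

∈⇒lookup : ∀ {m} {x : Fin m} {p : Subset m} → x ∈ p → lookup p x ≡ true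
∈⇒lookup = []=⇒lookup

lookup⇒∈ : ∀ {m} {x : Fin m} {p : Subset m} → lookup p x ≡ true → x ∈ p
lookup⇒∈ {x = x} {p} = lookup⇒[]= x p

TwinCover : (H : Graph) → Subset (n H) → Set
TwinCover H F = ∀ u v → u ≢ v → SameNbhd H u v → u ∈ F ⊎ v ∈ F

module Twins (H : Graph) where

  twin-sym : ∀ {u v} → SameNbhd H u v → SameNbhd H v u
  twin-sym t w = sym (t w)

  twin-trans : ∀ {u v w} → SameNbhd H u v → SameNbhd H v w → SameNbhd H u w
  twin-trans s t z = trans (s z) (t z)

  transpose-twin : ∀ {u v} → SameNbhd H u v → ∀ x → SameNbhd H (PC.transpose u v x) x
  transpose-twin {u} {v} t x with x ≟ u
  ... | yes refl = twin-sym t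
  ... | no _ with x ≟ v
  ...   | yes refl = t
  ...   | no _ = λ _ → refl

  transpose-automorphism : ∀ {u v} → SameNbhd H u v → IsAutomorphism H (transpose u v)
  transpose-automorphism {u} {v} t x y = begin
    adj H (τ x) (τ y) ≡⟨ transpose-twin t x (τ y) ⟩
    adj H x (τ y)     ≡⟨ Graph.sym H x (τ y) ⟩
    adj H (τ y) x     ≡⟨ transpose-twin t y x ⟩
    adj H y x         ≡⟨ Graph.sym H y x ⟩
    adj H x y         ∎
    where
    open ≡-Reasoning
    τ = PC.transpose u v

  automorphism-twin : ∀ σ → IsAutomorphism H σ → ∀ {u v} →
                      SameNbhd H u v → SameNbhd H (σ ⟨$⟩ʳ u) (σ ⟨$⟩ʳ v)
  automorphism-twin σ aut {u} {v} t z = begin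
    adj H (σ ⟨$⟩ʳ u) z                  ≡⟨ cong (adj H (σ ⟨$⟩ʳ u)) (sym (inverseʳ σ)) ⟩
    adj H (σ ⟨$⟩ʳ u) (σ ⟨$⟩ʳ (σ ⟨$⟩ˡ z)) ≡⟨ aut u (σ ⟨$⟩ˡ z) ⟩
    adj H u (σ ⟨$⟩ˡ z)                  ≡⟨ t (σ ⟨$⟩ˡ z) ⟩
    adj H v (σ ⟨$⟩ˡ z)                  ≡⟨ sym (aut v (σ ⟨$⟩ˡ z)) ⟩
    adj H (σ ⟨$⟩ʳ v) (σ ⟨$⟩ʳ (σ ⟨$⟩ˡ z)) ≡⟨ cong (adj H (σ ⟨$⟩ʳ v)) (inverseʳ σ) ⟩
    adj H (σ ⟨$⟩ʳ v) z                  ∎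
    where open ≡-Reasoning

  -- Every fixing set is a twin cover: if neither twin is in F, the swap of
  -- the two fixes F pointwise but is not the identity.
  fixing⇒twinCover : ∀ F → IsFixingSet H F → TwinCover H F
  fixing⇒twinCover F fixing u v u≢v t with u ∈? F | v ∈? F
  ... | yes u∈F | _       = inj₁ u∈F
  ... | no _    | yes v∈F = inj₂ v∈F
  ... | no u∉F  | no v∉F  = ⊥-elim (u≢v (sym (trans (sym (transpose-sends u v)) swap-fixes-u)))
    where
    swap-fixes-F : ∀ w → w ∈ F → PC.transpose u v w ≡ w
    swap-fixes-F w w∈F = transpose-fixes u v w (λ w≡u → u∉F (subst (_∈ F) w≡u w∈F))
                                               (λ w≡v → v∉F (subst (_∈ F) w≡v w∈F))
    swap-fixes-u : PC.transpose u v u ≡ u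
    swap-fixes-u = fixing (transpose u v) (transpose-automorphism t) swap-fixes-F u

  -- For
  -- v ∉ F pick a twin w ≠ v; then w ∈ F, so σ v is a twin of σ w = w, hence
  -- of v.  If σ v ≠ v then σ v ∈ F, so σ (σ v) = σ v, i.e. σ v = v anyway.
  twinCover⇒fixing : AllTwinClassesNontrivial H → ∀ F → TwinCover H F → IsFixingSet H F
  twinCover⇒fixing nontrivial F cover σ aut fixesF v with v ∈? F
  ... | yes v∈F = fixesF v v∈F
  ... | no v∉F with nontrivial v
  ...   | w , w≢v , v~w with cover v w (λ v≡w → w≢v (sym v≡w)) v~w
  ...     | inj₁ v∈F = ⊥-elim (v∉F v∈F)
  ...     | inj₂ w∈F with σ ⟨$⟩ʳ v ≟ v
  ...       | yes σv≡v = σv≡v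
  ...       | no σv≢v with cover (σ ⟨$⟩ʳ v) v σv≢v σv~v
    where
    σv~v : SameNbhd H (σ ⟨$⟩ʳ v) v
    σv~v = twin-trans (subst (SameNbhd H (σ ⟨$⟩ʳ v)) (fixesF w w∈F) (automorphism-twin σ aut v~w))
                      (twin-sym v~w)
  ...         | inj₂ v∈F = ⊥-elim (v∉F v∈F)
  ...         | inj₁ σv∈F = ⊥-elim (σv≢v (begin
    σ ⟨$⟩ʳ v                      ≡⟨ sym (inverseˡ σ) ⟩
    σ ⟨$⟩ˡ (σ ⟨$⟩ʳ (σ ⟨$⟩ʳ v)) ≡⟨ cong (σ ⟨$⟩ˡ_) (fixesF (σ ⟨$⟩ʳ v) σv∈F) ⟩
    σ ⟨$⟩ˡ (σ ⟨$⟩ʳ v)           ≡⟨ inverseˡ σ ⟩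
    v                             ∎))
    where open ≡-Reasoning

sumFin : (m : ℕ) → (Fin m → ℕ) → ℕ
sumFin zero    f = 0
sumFin (suc m) f = f zero + sumFin m (λ i → f (suc i))

indicator : Bool → ℕ
indicator true  = 1
indicator false = 0

∣∣≡sum-indicator : ∀ {m} (p : Subset m) → ∣ p ∣ ≡ sumFin m (λ i → indicator (lookup p i))
∣∣≡sum-indicator []          = refl
∣∣≡sum-indicator (true ∷ p)  = cong suc (∣∣≡sum-indicator p)
∣∣≡sum-indicator (false ∷ p) = ∣∣≡sum-indicator p

sumFin-cong : ∀ m {f g : Fin m → ℕ} → (∀ i → f i ≡ g i) → sumFin m f ≡ sumFin m g
sumFin-cong zero    f≡g = refl
sumFin-cong (suc m) f≡g = cong₂ _+_ (f≡g zero) (sumFin-cong m (λ i → f≡g (suc i)))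

sumFin-mono : ∀ m {f g : Fin m → ℕ} → (∀ i → f i ≤ g i) → sumFin m f ≤ sumFin m g
sumFin-mono zero    f≤g = z≤n
sumFin-mono (suc m) f≤g = +-mono-≤ (f≤g zero) (sumFin-mono m (λ i → f≤g (suc i)))

sumFin-const : ∀ m c → sumFin m (λ _ → c) ≡ m * c
sumFin-const zero    c = refl
sumFin-const (suc m) c = cong (c +_) (sumFin-const m c)

sumFin-++ : ∀ m k (f : Fin (m + k) → ℕ) →
            sumFin (m + k) f ≡ sumFin m (λ i → f (i ↑ˡ k)) + sumFin k (λ j → f (m ↑ʳ j))
sumFin-++ zero    k f = refl
sumFin-++ (suc m) k f = trans (cong (f zero +_) (sumFin-++ m k (λ i → f (suc i))))
                              (sym (+-assoc (f zero) _ _))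

sumFin-combine : ∀ m k (f : Fin (m * k) → ℕ) →
                 sumFin (m * k) f ≡ sumFin m (λ i → sumFin k (λ j → f (combine i j)))
sumFin-combine zero    k f = refl
sumFin-combine (suc m) k f =
  trans (sumFin-++ k (m * k) f)
        (cong (sumFin k (λ j → f (j ↑ˡ (m * k))) +_) (sumFin-combine m k (λ x → f (k ↑ʳ x))))

module ProductIndex (m k : ℕ) where

  row : Fin (m * k) → Fin m
  row x = proj₁ (remQuot {m} k x)

  col : Fin (m * k) → Fin k
  col x = proj₂ (remQuot {m} k x)

  row-combine : ∀ a b → row (combine a b) ≡ a
  row-combine a b = cong proj₁ (remQuot-combine {m} {k} a b)

  col-combine : ∀ a b → col (combine a b) ≡ b
  col-combine a b = cong proj₂ (remQuot-combine {m} {k} a b)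

  combine-row-col : ∀ x → combine (row x) (col x) ≡ x
  combine-row-col x = combine-remQuot {m} k x

  row-col-injective : ∀ {x y} → row x ≡ row y → col x ≡ col y → x ≡ y
  row-col-injective {x} {y} rx≡ry cx≡cy =
    trans (sym (combine-row-col x)) (trans (cong₂ combine rx≡ry cx≡cy) (combine-row-col y))

  slice : Subset (m * k) → Fin m → Subset k
  slice F a = tabulate (λ b → lookup F (combine a b))

  ∈-slice⁺ : ∀ F a b → combine a b ∈ F → b ∈ slice F a
  ∈-slice⁺ F a b ab∈F = lookup⇒∈ (trans (lookup∘tabulate _ b) (∈⇒lookup ab∈F))

  ∈-slice⁻ : ∀ F a b → b ∈ slice F a → combine a b ∈ F
  ∈-slice⁻ F a b b∈Fa = lookup⇒∈ (trans (sym (lookup∘tabulate _ b)) (∈⇒lookup b∈Fa))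

  ∣∣≡sum-slices : ∀ F → ∣ F ∣ ≡ sumFin m (λ a → ∣ slice F a ∣)
  ∣∣≡sum-slices F = trans (∣∣≡sum-indicator F) (trans (sumFin-combine m k _)
    (sumFin-cong m (λ a → sym (trans (∣∣≡sum-indicator (slice F a))
                                      (sumFin-cong k (λ b → cong indicator (lookup∘tabulate _ b)))))))

  cylinder : Subset k → Subset (m * k)
  cylinder E = tabulate (λ x → lookup E (col x))

  slice-cylinder : ∀ E a → slice (cylinder E) a ≡ E
  slice-cylinder E a = trans (tabulate-cong lookup-slice) (tabulate∘lookup E)
    where
    lookup-slice : ∀ b → lookup (cylinder E) (combine a b) ≡ lookup E b
    lookup-slice b = trans (lookup∘tabulate _ (combine a b)) (cong (lookup E) (col-combine a b))

  ∣cylinder∣ : ∀ E → ∣ cylinder E ∣ ≡ m * ∣ E ∣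
  ∣cylinder∣ E = trans (∣∣≡sum-slices (cylinder E))
    (trans (sumFin-cong m (λ a → cong ∣_∣ (slice-cylinder E a))) (sumFin-const m ∣ E ∣))

∨-twin-cancel : ∀ A C β → A ≡ C ∨ β → A ∨ β ≡ C → A ≡ C
∨-twin-cancel false false _ _   _   = refl
∨-twin-cancel true  true  _ _   _   = refl
∨-twin-cancel false true  _ A≡C _   = A≡C
∨-twin-cancel true  false _ _   A≡C = A≡C

∨-loop : (G : Graph) → ∀ A u → A ∨ adj G u u ≡ A
∨-loop G A u = trans (cong (A ∨_) (irr G u)) (∨-identityʳ A)

module Product (G₁ G₂ : Graph) where
  open ProductIndex (n G₁) (n G₂)
  open Twins

  P : Graph
  P = G₁ ⊛ G₂

  adj-combine : ∀ x a b → adj P x (combine a b) ≡ adj G₁ (row x) a ∨ adj G₂ (col x) b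
  adj-combine x a b = cong₂ _∨_ (cong (adj G₁ (row x)) (row-combine a b))
                                (cong (adj G₂ (col x)) (col-combine a b))

  twin-combine : ∀ a {b d} → SameNbhd G₂ b d → SameNbhd P (combine a b) (combine a d)
  twin-combine a {b} {d} b~d z = cong₂ _∨_
    (cong (λ c → adj G₁ c (row z)) (trans (row-combine a b) (sym (row-combine a d))))
    (trans (cong (λ c → adj G₂ c (col z)) (col-combine a b))
           (trans (b~d (col z)) (cong (λ c → adj G₂ c (col z)) (sym (col-combine a d)))))

  -- Testing N(x) = N(y) at (w, col x) and (w, col y)
  -- shows N(row x) = N(row y); testing it at (row x, e) compares the columns.
  twin-product : NoFalseTwins G₁ → ∀ {x y} → SameNbhd P x y →
                 row x ≡ row y × SameNbhd G₂ (col x) (col y)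
  twin-product noTwins {x} {y} x~y = same-row , col-twins
    where
    a = row x
    b = col x
    c = row y
    d = col y
    at : ∀ w e → adj G₁ a w ∨ adj G₂ b e ≡ adj G₁ c w ∨ adj G₂ d e
    at w e = trans (sym (adj-combine x w e)) (trans (x~y (combine w e)) (adj-combine y w e))
    same-row : a ≡ c
    same-row = noTwins a c λ w → ∨-twin-cancel (adj G₁ a w) (adj G₁ c w) (adj G₂ d b)
      (trans (sym (∨-loop G₂ (adj G₁ a w) b)) (at w b))
      (trans (cong (adj G₁ a w ∨_) (Graph.sym G₂ d b)) (trans (at w d) (∨-loop G₂ (adj G₁ c w) d)))
    col-twins : SameNbhd G₂ b d
    col-twins e = begin
      adj G₂ b e                 ≡⟨ cong (_∨ adj G₂ b e) (sym (irr G₁ a)) ⟩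
      adj G₁ a a ∨ adj G₂ b e    ≡⟨ at a e ⟩
      adj G₁ c a ∨ adj G₂ d e    ≡⟨ cong (λ r → adj G₁ r a ∨ adj G₂ d e) (sym same-row) ⟩
      adj G₁ a a ∨ adj G₂ d e    ≡⟨ cong (_∨ adj G₂ d e) (irr G₁ a) ⟩
      adj G₂ d e                 ∎
      where open ≡-Reasoning

  nontrivial-product : AllTwinClassesNontrivial G₂ → AllTwinClassesNontrivial P
  nontrivial-product nontrivial x with nontrivial (col x)
  ... | d , d≢cx , cx~d = combine (row x) d , y≢x , x~y
    where
    y≢x : combine (row x) d ≢ x
    y≢x y≡x = d≢cx (trans (sym (col-combine (row x) d)) (cong col y≡x))
    x~y : SameNbhd P x (combine (row x) d)
    x~y = subst (λ z → SameNbhd P z (combine (row x) d)) (combine-row-col x)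
                (twin-combine (row x) cx~d)

  twinCover⇒slices : ∀ F → TwinCover P F → ∀ a → TwinCover G₂ (slice F a)
  twinCover⇒slices F cover a b d b≢d b~d
    with cover (combine a b) (combine a d) ab≢ad (twin-combine a b~d)
    where
    ab≢ad : combine a b ≢ combine a d
    ab≢ad ab≡ad = b≢d (trans (sym (col-combine a b)) (trans (cong col ab≡ad) (col-combine a d)))
  ... | inj₁ ab∈F = inj₁ (∈-slice⁺ F a b ab∈F)
  ... | inj₂ ad∈F = inj₂ (∈-slice⁺ F a d ad∈F)

  slices⇒twinCover : NoFalseTwins G₁ → ∀ F → (∀ a → TwinCover G₂ (slice F a)) → TwinCover P F
  slices⇒twinCover noTwins F cover x y x≢y x~y with twin-product noTwins x~y
  ... | rx≡ry , cx~cy with cover (row x) (col x) (col y) (λ cx≡cy → x≢y (row-col-injective rx≡ry cx≡cy)) cx~cy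
  ...   | inj₁ cx∈ = inj₁ (subst (_∈ F) (combine-row-col x) (∈-slice⁻ F (row x) (col x) cx∈))
  ...   | inj₂ cy∈ = inj₂ (subst (_∈ F) (trans (cong (λ r → combine r (col y)) rx≡ry) (combine-row-col y))
                                        (∈-slice⁻ F (row x) (col y) cy∈))

  fixing⇒slices-fixing : AllTwinClassesNontrivial G₂ → ∀ F → IsFixingSet P F →
                         ∀ a → IsFixingSet G₂ (slice F a)
  fixing⇒slices-fixing nontrivial F fixing a =
    twinCover⇒fixing G₂ nontrivial (slice F a) (twinCover⇒slices F (fixing⇒twinCover P F fixing) a)

  slices-fixing⇒fixing : NoFalseTwins G₁ → AllTwinClassesNontrivial G₂ → ∀ F →
                         (∀ a → IsFixingSet G₂ (slice F a)) → IsFixingSet P F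
  slices-fixing⇒fixing noTwins nontrivial F fixing =
    twinCover⇒fixing P (nontrivial-product nontrivial) F
      (slices⇒twinCover noTwins F (λ a → fixing⇒twinCover G₂ (slice F a) (fixing a)))

theorem3p13 : (G₁ G₂ : Graph) → Connected G₁ → NoFalseTwins G₁ →
              AllTwinClassesNontrivial G₂ →
              ∀ (k : ℕ) → FixNumber G₂ k → FixNumber (G₁ ⊛ G₂) (n G₁ * k)
theorem3p13 G₁ G₂ _ noTwins nontrivial k ((F₂ , F₂-fixing , ∣F₂∣≡k) , F₂-minimum) =
  (cylinder F₂ , cylinder-fixing , cylinder-size) , lower-bound
  where
  open ProductIndex (n G₁) (n G₂)
  open Product G₁ G₂

  cylinder-fixing : IsFixingSet P (cylinder F₂)
  cylinder-fixing = slices-fixing⇒fixing noTwins nontrivial (cylinder F₂)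
    (λ a → subst (IsFixingSet G₂) (sym (slice-cylinder F₂ a)) F₂-fixing)

  cylinder-size : ∣ cylinder F₂ ∣ ≡ n G₁ * k
  cylinder-size = trans (∣cylinder∣ F₂) (cong (n G₁ *_) ∣F₂∣≡k)

  lower-bound : ∀ F → IsFixingSet P F → n G₁ * k ≤ ∣ F ∣
  lower-bound F F-fixing = subst₂ _≤_ (sumFin-const (n G₁) k) (sym (∣∣≡sum-slices F))
    (sumFin-mono (n G₁) (λ a → F₂-minimum (slice F a) (fixing⇒slices-fixing nontrivial F F-fixing a)))
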